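{- Let $u:\mathbf{N}\to\mathbf{N}$ be completely multiplicative. Then the sequence of quantum integers $\{[u(n)]_q\}_{n=1}^\infty$ and the sequence of powers $\{q^{u(n)-1}\}_{n=1}^\infty$ are both solutions of the functional equation $f_{mn}(q)=f_m(q)f_n\left(q^{u(m)}\right)$ for all $m,n\in\mathbf{N}$.
   Context: $\mathbf{N}=\{1,2,3,\dots\}$. A function $u:\mathbf{N}\to\mathbf{N}$ is completely multiplicative if $u(mn)=u(m)u(n)$ for all $m,n$. For a positive integer $n$, the quantum integer $[n]_q$ is the polynomial $1+q+q^2+\cdots+q^{n-1}$. -}

module Defs where

open import Data.Nat using (ℕ; zero; suc; _+_; _*_; _∸_; _≤_)
open import Data.List using (List; []; _∷_; replicate; _++_; map)
open import Relation.Binary.PropositionalEquality using (_≡_)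

-- Polynomials in q with coefficients in ℕ, as coefficient lists
-- (constant term first).  Equality is coefficientwise (so trailing
-- zeros do not matter).
Poly : Set
Poly = List ℕ

coeff : Poly → ℕ → ℕ
coeff []       _       = 0
coeff (a ∷ _)  zero    = a
coeff (_ ∷ p)  (suc i) = coeff p i

infix 4 _≈ₚ_
_≈ₚ_ : Poly → Poly → Set
p ≈ₚ r = ∀ i → coeff p i ≡ coeff r i

infixl 6 _+ₚ_
_+ₚ_ : Poly → Poly → Poly
[]      +ₚ r       = r
(a ∷ p) +ₚ []      = a ∷ p
(a ∷ p) +ₚ (b ∷ r) = (a + b) ∷ (p +ₚ r)

infixl 7 _*ₚ_
_*ₚ_ : Poly → Poly → Poly
[]      *ₚ r = []
(a ∷ p) *ₚ r = map (a *_) r +ₚ (0 ∷ (p *ₚ r))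

shift : ℕ → Poly → Poly
shift k p = replicate k 0 ++ p

-- substitution q ↦ q^k :  (subst k f)(q) = f(q^k)
substPow : ℕ → Poly → Poly
substPow k []      = []
substPow k (a ∷ p) = (a ∷ []) +ₚ shift k (substPow k p)

quantum : ℕ → Poly
quantum n = replicate n 1

monomial : ℕ → Poly
monomial d = replicate d 0 ++ (1 ∷ [])

-- u : N → N (N = {1,2,...}) completely multiplicative, with u modelled
-- as a function ℕ → ℕ whose values on positive inputs are positive.
IsPositiveValued : (ℕ → ℕ) → Set
IsPositiveValued u = ∀ n → 1 ≤ n → 1 ≤ u n

CompletelyMultiplicative : (ℕ → ℕ) → Set
CompletelyMultiplicative u = ∀ m n → 1 ≤ m → 1 ≤ n → u (m * n) ≡ u m * u n

IsSolution : (ℕ → ℕ) → (ℕ → Poly) → Set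
IsSolution u f = ∀ m n → 1 ≤ m → 1 ≤ n →
  f (m * n) ≈ₚ f m *ₚ substPow (u m) (f n)

{-# OPTIONS --safe #-}
-- Both sequences have the form F ∘ u, with F n = [n]_q and F n = q^(n-1), and
-- each F already solves the equation for u = id: [a + ab]_q = [a]_q + q^a [ab]_q
-- gives [ab]_q = [a]_q [b]_{q^a} by induction on b, and q^(ab-1) = q^(a-1) (q^a)^(b-1).
-- Complete multiplicativity of u turns a solution F for u = id into the
-- solution F ∘ u for u, by applying it at u m and u n.
module Submission where

open import Defs
open import Data.Nat using (ℕ; _∸_; zero; suc; _+_; _*_; _≤_)
open import Data.Nat.Properties
  using (+-identityʳ; *-identityʳ; *-zeroʳ; *-suc; *-distribˡ-+; +-commutativeSemigroup)
open import Data.Nat.Tactic.RingSolver using (solve)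
open import Data.List using ([]; _∷_; replicate; _++_; map; length)
open import Data.List.Properties using (++-assoc; ++-identityʳ; length-replicate)
open import Data.Product using (_×_; _,_)
open import Function using (id; _∘_)
open import Level using (0ℓ)
open import Relation.Binary using (IsEquivalence; Setoid)
open import Relation.Binary.PropositionalEquality
  using (_≡_; refl; sym; trans; cong; cong₂; subst; module ≡-Reasoning)
open import Algebra.Properties.CommutativeSemigroup +-commutativeSemigroup
  using (interchange)

-- _≈ₚ_ unfolds to a function type, from which Agda cannot infer the two
-- polynomials; this record wrapper makes them inferable.
infix 4 _≋_
record _≋_ (p r : Poly) : Set where
  constructor coeffwise
  field coeff-≡ : p ≈ₚ r

open _≋_

≋-isEquivalence : IsEquivalence _≋_
≋-isEquivalence = record
  { refl  = coeffwise λ _ → refl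
  ; sym   = λ p≋r → coeffwise λ i → sym (coeff-≡ p≋r i)
  ; trans = λ p≋r r≋s → coeffwise λ i → trans (coeff-≡ p≋r i) (coeff-≡ r≋s i)
  }

≋-setoid : Setoid 0ℓ 0ℓ
≋-setoid = record { isEquivalence = ≋-isEquivalence }

open Setoid ≋-setoid using () renaming (refl to ≋-refl; sym to ≋-sym; reflexive to ≡⇒≋)

∷-cong : ∀ {a b p r} → a ≡ b → p ≋ r → a ∷ p ≋ b ∷ r
∷-cong a≡b p≋r = coeffwise λ { zero → a≡b ; (suc i) → coeff-≡ p≋r i }

coeff-replicate-0 : ∀ n i → coeff (replicate n 0) i ≡ 0
coeff-replicate-0 zero    i       = refl
coeff-replicate-0 (suc n) zero    = refl
coeff-replicate-0 (suc n) (suc i) = coeff-replicate-0 n i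

replicate-0≋[] : ∀ n → replicate n 0 ≋ []
replicate-0≋[] n = coeffwise (coeff-replicate-0 n)

coeff-+ₚ : ∀ p r i → coeff (p +ₚ r) i ≡ coeff p i + coeff r i
coeff-+ₚ []      r       i       = refl
coeff-+ₚ (a ∷ p) []      zero    = sym (+-identityʳ a)
coeff-+ₚ (a ∷ p) []      (suc i) = sym (+-identityʳ (coeff p i))
coeff-+ₚ (a ∷ p) (b ∷ r) zero    = refl
coeff-+ₚ (a ∷ p) (b ∷ r) (suc i) = coeff-+ₚ p r i

coeff-map-* : ∀ a r i → coeff (map (a *_) r) i ≡ a * coeff r i
coeff-map-* a []      i       = sym (*-zeroʳ a)
coeff-map-* a (b ∷ r) zero    = refl
coeff-map-* a (b ∷ r) (suc i) = coeff-map-* a r i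

+ₚ-cong : ∀ {p p′ r r′} → p ≋ p′ → r ≋ r′ → p +ₚ r ≋ p′ +ₚ r′
+ₚ-cong {p} {p′} {r} {r′} p≋p′ r≋r′ = coeffwise λ i →
  trans (coeff-+ₚ p r i)
    (trans (cong₂ _+_ (coeff-≡ p≋p′ i) (coeff-≡ r≋r′ i)) (sym (coeff-+ₚ p′ r′ i)))

+ₚ-interchange : ∀ p r s t → (p +ₚ r) +ₚ (s +ₚ t) ≋ (p +ₚ s) +ₚ (r +ₚ t)
+ₚ-interchange p r s t = coeffwise λ i → begin
    coeff ((p +ₚ r) +ₚ (s +ₚ t)) i
  ≡⟨ trans (coeff-+ₚ (p +ₚ r) (s +ₚ t) i) (cong₂ _+_ (coeff-+ₚ p r i) (coeff-+ₚ s t i)) ⟩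
    (coeff p i + coeff r i) + (coeff s i + coeff t i)
  ≡⟨ interchange (coeff p i) (coeff r i) (coeff s i) (coeff t i) ⟩
    (coeff p i + coeff s i) + (coeff r i + coeff t i)
  ≡⟨ sym (trans (coeff-+ₚ (p +ₚ s) (r +ₚ t) i) (cong₂ _+_ (coeff-+ₚ p s i) (coeff-+ₚ r t i))) ⟩
    coeff ((p +ₚ s) +ₚ (r +ₚ t)) i
  ∎
  where open ≡-Reasoning

open import Relation.Binary.Reasoning.Setoid ≋-setoid

map-*-cong : ∀ a {r r′} → r ≋ r′ → map (a *_) r ≋ map (a *_) r′
map-*-cong a {r} {r′} r≋r′ = coeffwise λ i →
  trans (coeff-map-* a r i) (trans (cong (a *_) (coeff-≡ r≋r′ i)) (sym (coeff-map-* a r′ i)))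

map-*-+ₚ : ∀ a r s → map (a *_) (r +ₚ s) ≡ map (a *_) r +ₚ map (a *_) s
map-*-+ₚ a []      s       = refl
map-*-+ₚ a (b ∷ r) []      = refl
map-*-+ₚ a (b ∷ r) (c ∷ s) = cong₂ _∷_ (*-distribˡ-+ a b c) (map-*-+ₚ a r s)

*ₚ-congʳ : ∀ p {r r′} → r ≋ r′ → p *ₚ r ≋ p *ₚ r′
*ₚ-congʳ []      r≋r′ = ≋-refl
*ₚ-congʳ (a ∷ p) r≋r′ = +ₚ-cong (map-*-cong a r≋r′) (∷-cong refl (*ₚ-congʳ p r≋r′))

*ₚ-distribˡ-+ₚ : ∀ p r s → p *ₚ (r +ₚ s) ≋ p *ₚ r +ₚ p *ₚ s
*ₚ-distribˡ-+ₚ []      r s = ≋-refl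
*ₚ-distribˡ-+ₚ (a ∷ p) r s = begin
  map (a *_) (r +ₚ s) +ₚ (0 ∷ p *ₚ (r +ₚ s))
    ≈⟨ +ₚ-cong (≡⇒≋ (map-*-+ₚ a r s)) (∷-cong refl (*ₚ-distribˡ-+ₚ p r s)) ⟩
  (map (a *_) r +ₚ map (a *_) s) +ₚ ((0 ∷ p *ₚ r) +ₚ (0 ∷ p *ₚ s))
    ≈⟨ +ₚ-interchange (map (a *_) r) (map (a *_) s) (0 ∷ p *ₚ r) (0 ∷ p *ₚ s) ⟩
  (a ∷ p) *ₚ r +ₚ (a ∷ p) *ₚ s
    ∎

*ₚ-zeroʳ : ∀ p → p *ₚ [] ≋ []
*ₚ-zeroʳ []      = ≋-refl
*ₚ-zeroʳ (a ∷ p) = coeffwise λ { zero → refl ; (suc i) → coeff-≡ (*ₚ-zeroʳ p) i }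

*ₚ-identityʳ : ∀ p → p *ₚ (1 ∷ []) ≋ p
*ₚ-identityʳ []      = ≋-refl
*ₚ-identityʳ (a ∷ p) = ∷-cong (trans (+-identityʳ (a * 1)) (*-identityʳ a)) (*ₚ-identityʳ p)

*ₚ-0∷ʳ : ∀ p r → p *ₚ (0 ∷ r) ≋ 0 ∷ p *ₚ r
*ₚ-0∷ʳ []      r = ≋-sym (replicate-0≋[] 1)
*ₚ-0∷ʳ (a ∷ p) r =
  ∷-cong (trans (+-identityʳ (a * 0)) (*-zeroʳ a)) (+ₚ-cong ≋-refl (*ₚ-0∷ʳ p r))

shift-cong : ∀ k {p r} → p ≋ r → shift k p ≋ shift k r
shift-cong zero    p≋r = p≋r
shift-cong (suc k) p≋r = ∷-cong refl (shift-cong k p≋r)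

*ₚ-shiftʳ : ∀ p k r → p *ₚ shift k r ≋ shift k (p *ₚ r)
*ₚ-shiftʳ p zero    r = ≋-refl
*ₚ-shiftʳ p (suc k) r = begin
  p *ₚ (0 ∷ shift k r)   ≈⟨ *ₚ-0∷ʳ p (shift k r) ⟩
  0 ∷ p *ₚ shift k r     ≈⟨ ∷-cong refl (*ₚ-shiftʳ p k r) ⟩
  0 ∷ shift k (p *ₚ r)   ∎

*ₚ-monomialʳ : ∀ p d → p *ₚ monomial d ≋ shift d p
*ₚ-monomialʳ p d = begin
  p *ₚ shift d (1 ∷ [])    ≈⟨ *ₚ-shiftʳ p d (1 ∷ []) ⟩
  shift d (p *ₚ (1 ∷ []))  ≈⟨ shift-cong d (*ₚ-identityʳ p) ⟩
  shift d p                ∎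

replicate-+ : ∀ m n (x : ℕ) → replicate (m + n) x ≡ replicate m x ++ replicate n x
replicate-+ zero    n x = refl
replicate-+ (suc m) n x = cong (x ∷_) (replicate-+ m n x)

shift-+ : ∀ m n p → shift (m + n) p ≡ shift m (shift n p)
shift-+ m n p = trans (cong (_++ p) (replicate-+ m n 0)) (++-assoc (replicate m 0) (replicate n 0) p)

++≋+ₚ-shift : ∀ p r → p ++ r ≋ p +ₚ shift (length p) r
++≋+ₚ-shift []      r = ≋-refl
++≋+ₚ-shift (a ∷ p) r = ∷-cong (sym (+-identityʳ a)) (++≋+ₚ-shift p r)

substPow-const : ∀ a x → substPow a (x ∷ []) ≋ x ∷ []
substPow-const a x = begin
  (x ∷ []) +ₚ (replicate a 0 ++ [])  ≡⟨ cong ((x ∷ []) +ₚ_) (++-identityʳ (replicate a 0)) ⟩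
  (x ∷ []) +ₚ replicate a 0          ≈⟨ +ₚ-cong ≋-refl (replicate-0≋[] a) ⟩
  x ∷ []                              ∎

substPow-shift : ∀ a c p → substPow a (shift c p) ≋ shift (c * a) (substPow a p)
substPow-shift a zero    p = ≋-refl
substPow-shift a (suc c) p = begin
  (0 ∷ []) +ₚ shift a (substPow a (shift c p))  ≈⟨ +ₚ-cong (replicate-0≋[] 1) ≋-refl ⟩
  shift a (substPow a (shift c p))              ≈⟨ shift-cong a (substPow-shift a c p) ⟩
  shift a (shift (c * a) (substPow a p))        ≡⟨ shift-+ a (c * a) (substPow a p) ⟨
  shift (a + c * a) (substPow a p)              ∎

substPow-monomial : ∀ a c → substPow a (monomial c) ≋ monomial (c * a)
substPow-monomial a c = begin
  substPow a (shift c (1 ∷ []))         ≈⟨ substPow-shift a c (1 ∷ []) ⟩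
  shift (c * a) (substPow a (1 ∷ []))   ≈⟨ shift-cong (c * a) (substPow-const a 1) ⟩
  shift (c * a) (1 ∷ [])                ∎

quantum-* : ∀ a b → quantum (a * b) ≋ quantum a *ₚ substPow a (quantum b)
quantum-* a zero    = begin
  quantum (a * 0)          ≡⟨ cong quantum (*-zeroʳ a) ⟩
  []                       ≈⟨ *ₚ-zeroʳ (quantum a) ⟨
  quantum a *ₚ []          ∎
quantum-* a (suc b) = begin
  quantum (a * suc b)                            ≡⟨ cong quantum (*-suc a b) ⟩
  quantum (a + a * b)                            ≡⟨ replicate-+ a (a * b) 1 ⟩
  quantum a ++ quantum (a * b)                   ≈⟨ ++≋+ₚ-shift (quantum a) (quantum (a * b)) ⟩
  quantum a +ₚ shift (length (quantum a)) (quantum (a * b))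
    ≡⟨ cong (λ k → quantum a +ₚ shift k (quantum (a * b))) (length-replicate a) ⟩
  quantum a +ₚ shift a (quantum (a * b))
    ≈⟨ +ₚ-cong (≋-sym (*ₚ-identityʳ (quantum a))) (shift-cong a (quantum-* a b)) ⟩
  quantum a *ₚ (1 ∷ []) +ₚ shift a (quantum a *ₚ S)
    ≈⟨ +ₚ-cong ≋-refl (*ₚ-shiftʳ (quantum a) a S) ⟨
  quantum a *ₚ (1 ∷ []) +ₚ quantum a *ₚ shift a S
    ≈⟨ *ₚ-distribˡ-+ₚ (quantum a) (1 ∷ []) (shift a S) ⟨
  quantum a *ₚ ((1 ∷ []) +ₚ shift a S)           ∎
  where S = substPow a (quantum b)

monomial-∸1-* : ∀ a b → 1 ≤ b →
  monomial (a * b ∸ 1) ≋ monomial (a ∸ 1) *ₚ substPow a (monomial (b ∸ 1))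
monomial-∸1-* a (suc c) _ = begin
  monomial (a * suc c ∸ 1)                  ≡⟨ cong monomial (exponent a) ⟩
  monomial (c * a + (a ∸ 1))                ≡⟨ shift-+ (c * a) (a ∸ 1) (1 ∷ []) ⟩
  shift (c * a) (monomial (a ∸ 1))          ≈⟨ *ₚ-monomialʳ (monomial (a ∸ 1)) (c * a) ⟨
  monomial (a ∸ 1) *ₚ monomial (c * a)      ≈⟨ *ₚ-congʳ (monomial (a ∸ 1)) (substPow-monomial a c) ⟨
  monomial (a ∸ 1) *ₚ substPow a (monomial c) ∎
  where
  exponent : ∀ a → a * suc c ∸ 1 ≡ c * a + (a ∸ 1)
  exponent zero    = sym (trans (+-identityʳ (c * 0)) (*-zeroʳ c))
  exponent (suc a) = c+a*[1+c]≡c*[1+a]+a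
    where
    c+a*[1+c]≡c*[1+a]+a : c + a * suc c ≡ c * suc a + a
    c+a*[1+c]≡c*[1+a]+a = solve (a ∷ c ∷ [])

isSolution-∘ : ∀ F {u} → IsPositiveValued u → CompletelyMultiplicative u →
  IsSolution id F → IsSolution u (F ∘ u)
isSolution-∘ F {u} pos mult sol m n 1≤m 1≤n =
  subst (λ k → F k ≈ₚ F (u m) *ₚ substPow (u m) (F (u n)))
    (sym (mult m n 1≤m 1≤n)) (sol (u m) (u n) (pos m 1≤m) (pos n 1≤n))

quantum-isSolution : IsSolution id quantum
quantum-isSolution m n _ _ = coeff-≡ (quantum-* m n)

monomial-∸1-isSolution : IsSolution id (λ n → monomial (n ∸ 1))
monomial-∸1-isSolution m n _ 1≤n = coeff-≡ (monomial-∸1-* m n 1≤n)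

theorem3 : (u : ℕ → ℕ) → IsPositiveValued u → CompletelyMultiplicative u →
    IsSolution u (λ n → quantum (u n)) × IsSolution u (λ n → monomial (u n ∸ 1))
theorem3 u pos mult =
    isSolution-∘ quantum pos mult quantum-isSolution
  , isSolution-∘ (λ n → monomial (n ∸ 1)) pos mult monomial-∸1-isSolution
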